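{- Let $F$ be a cubic 2-connected graph and let $G = F^\Delta$. Let $E \subset E(G)$ with $|E| = 2$. Then $G - E$ (the graph obtained by deleting the edges of $E$) has a $\Lambda$-factor.
   Context: Graphs are finite, undirected, simple. For a cubic graph $F$, $F^\Delta$ is the graph obtained by replacing each vertex $x$ of $F$, with neighbours $x_1,x_2,x_3$, by a triangle: delete $x$, add new vertices $t_1,t_2,t_3$ forming a triangle, and add edges $x_it_i$. A $\Lambda$-factor of a graph $H$ is a spanning subgraph of $H$ every component of which is a 3-vertex path. -}

module Defs where

open import Data.Nat using (ℕ; _≤_)
open import Data.Fin using (Fin)
open import Data.Bool using (Bool; true; false; T)
open import Data.Product using (Σ; Σ-syntax; ∃; ∃-syntax; _×_; _,_; proj₁; proj₂)
open import Data.Sum using (_⊎_)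
open import Relation.Nullary using (¬_)
open import Relation.Binary.PropositionalEquality using (_≡_; _≢_)
open import Relation.Binary.Construct.Closure.ReflexiveTransitive using (Star)
open import Level using () renaming (suc to lsuc; zero to lzero)

SamePair : {V : Set} → V → V → V → V → Set
SamePair a b u w = (u ≡ a × w ≡ b) ⊎ (u ≡ b × w ≡ a)

In3 : {V : Set} → V → V → V → V → Set
In3 a b c u = u ≡ a ⊎ u ≡ b ⊎ u ≡ c

ComponentIsP3 : {V : Set} → (V → V → Set) → V → Set
ComponentIsP3 {V} H v =
  Σ[ a ∈ V ] Σ[ b ∈ V ] Σ[ c ∈ V ]
    (a ≢ b) × (b ≢ c) × (a ≢ c)
    × H a b × H b c
    × (∀ u w → In3 a b c u → H u w → SamePair a b u w ⊎ SamePair b c u w)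
    × (∀ w → (Star H v w → In3 a b c w) × (In3 a b c w → Star H v w))

ΛFactor : {V : Set} → (V → V → Set) → Set₁
ΛFactor {V} A =
  Σ[ H ∈ (V → V → Set) ]
    (∀ u w → H u w → A u w)
    × (∀ u w → H u w → H w u)
    × (∀ v → ComponentIsP3 H v)

DeleteTwo : {V : Set} → (V → V → Set) → V → V → V → V → (V → V → Set)
DeleteTwo A p₁ q₁ p₂ q₂ u w =
  A u w × ¬ SamePair p₁ q₁ u w × ¬ SamePair p₂ q₂ u w

Graph : ℕ → Set
Graph n = Fin n → Fin n → Bool

module _ {n : ℕ} (F : Graph n) where

  Edge : Fin n → Fin n → Set
  Edge x y = T (F x y)

  IsSimple : Set
  IsSimple = (∀ x y → F x y ≡ F y x) × (∀ x → F x x ≡ false)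

  Cubic : Set
  Cubic = ∀ x → Σ[ y₁ ∈ Fin n ] Σ[ y₂ ∈ Fin n ] Σ[ y₃ ∈ Fin n ]
    (y₁ ≢ y₂) × (y₁ ≢ y₃) × (y₂ ≢ y₃)
    × Edge x y₁ × Edge x y₂ × Edge x y₃
    × (∀ y → Edge x y → In3 y₁ y₂ y₃ y)

  EdgeWithout : Fin n → Fin n → Fin n → Set
  EdgeWithout x u w = Edge u w × u ≢ x × w ≢ x

  Connected : Set
  Connected = ∀ u w → Star Edge u w

  TwoConnected : Set
  TwoConnected = (3 ≤ n) × Connected
    × (∀ x u w → u ≢ x → w ≢ x → Star (EdgeWithout x) u w)

  -- Vertices of F^Δ: darts (x , y) with xy ∈ E(F); the dart (x , y) is the
  -- triangle vertex t at x attached to the neighbour y.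
  Dart : Set
  Dart = Σ (Fin n × Fin n) (λ p → Edge (proj₁ p) (proj₂ p))

  -- Edges of F^Δ: triangle edges (x,y)(x,y') with y ≠ y', and the
  -- edges (x,y)(y,x) corresponding to the original edges xy.
  EdgeΔ : Dart → Dart → Set
  EdgeΔ ((x , y) , _) ((x' , y') , _) =
    (x ≡ x' × y ≢ y') ⊎ (x ≡ y' × y ≡ x')

-- For vertex-disjoint oriented cycles of F (each of length at least 3) and a choice of a
-- neighbour m u of every vertex u, the following spanning subgraph of F^Δ is a Λ-factor: for each
-- cycle vertex v with predecessor p and remaining neighbour z the path (v,z) – (v,p) – (p,v), and
-- for each vertex u off the cycles the triangle at u minus the edge opposite to the dart (u, m u).
-- If the two deleted edges do not lie in a common triangle, take no cycles and choose each m u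
-- away from the ends of the deleted edge in the triangle at u. Otherwise both lie in the triangle
-- at some x and so share a dart (x,y). Since F is 2-connected, xy lies on a cycle; oriented so that
-- y follows x, it makes the factor avoid every triangle edge at (x,y).
module Submission where

open import Defs
open import Data.Bool using (T)
open import Data.Bool.Properties using (T-irrelevant)
open import Data.Empty using (⊥; ⊥-elim)
open import Data.Fin using (Fin; _≟_)
open import Data.Nat as ℕ using (ℕ; zero; suc; _+_; _∸_; _≤_; _<_; z≤n; s≤s)
open import Data.Nat.Properties
  using (≤-refl; ≤-trans; <⇒≤; ≤-pred; <-irrefl; ≤∧≢⇒<; 1+n≰n; m+1+n≢n; suc-injective;
         m≤n⇒m≤1+n; m≤n⇒m<n∨m≡n; m≤o∸n⇒m+n≤o; m∸n+n≡m; +-cancelʳ-≡)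
open import Data.Product using (Σ-syntax; ∃; ∃₂; _×_; _,_; proj₁; proj₂)
open import Data.Sum as ⊎ using (_⊎_; inj₁; inj₂; [_,_]′; swap)
open import Function using (_∘_)
open import Relation.Binary.Construct.Closure.ReflexiveTransitive using (Star; ε; _◅_; _◅◅_)
open import Relation.Binary.Definitions using (DecidableEquality)
open import Relation.Binary.PropositionalEquality
  using (_≡_; _≢_; refl; sym; trans; cong; subst; ≢-sym)
open import Relation.Nullary using (¬_; Dec; yes; no; contradiction)
open import Relation.Nullary.Decidable using (_×-dec_; _⊎-dec_)

In2 : {V : Set} → V → V → V → Set
In2 a b u = u ≡ a ⊎ u ≡ b

module _ {V : Set} where

  In2-pigeonhole : {a b x y z : V} → In2 a b x → In2 a b y → In2 a b z →
    x ≢ y → x ≢ z → y ≢ z → ⊥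
  In2-pigeonhole (inj₁ refl) (inj₁ refl) _           x≢y _   _   = x≢y refl
  In2-pigeonhole (inj₂ refl) (inj₂ refl) _           x≢y _   _   = x≢y refl
  In2-pigeonhole (inj₁ refl) (inj₂ refl) (inj₁ refl) _   x≢z _   = x≢z refl
  In2-pigeonhole (inj₁ refl) (inj₂ refl) (inj₂ refl) _   _   y≢z = y≢z refl
  In2-pigeonhole (inj₂ refl) (inj₁ refl) (inj₁ refl) _   _   y≢z = y≢z refl
  In2-pigeonhole (inj₂ refl) (inj₁ refl) (inj₂ refl) _   x≢z _   = x≢z refl

  In3-without₁ : {a b c u : V} → In3 a b c u → a ≢ u → In2 b c u
  In3-without₁ (inj₁ refl) a≢u = ⊥-elim (a≢u refl)
  In3-without₁ (inj₂ u∈)   _   = u∈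

  In3-without₂ : {a b c u : V} → In3 a b c u → b ≢ u → In2 a c u
  In3-without₂ (inj₁ u≡a)          _   = inj₁ u≡a
  In3-without₂ (inj₂ (inj₁ refl)) b≢u = ⊥-elim (b≢u refl)
  In3-without₂ (inj₂ (inj₂ u≡c))  _   = inj₂ u≡c

  In3-without₃ : {a b c u : V} → In3 a b c u → c ≢ u → In2 a b u
  In3-without₃ (inj₁ u≡a)          _   = inj₁ u≡a
  In3-without₃ (inj₂ (inj₁ u≡b))  _   = inj₂ u≡b
  In3-without₃ (inj₂ (inj₂ refl)) c≢u = ⊥-elim (c≢u refl)

  In3-pigeonhole : {a b c w x y z : V} →
    In3 a b c w → In3 a b c x → In3 a b c y → In3 a b c z →
    w ≢ x → w ≢ y → w ≢ z → x ≢ y → x ≢ z → y ≢ z → ⊥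
  In3-pigeonhole (inj₁ refl) x∈ y∈ z∈ w≢x w≢y w≢z =
    In2-pigeonhole (In3-without₁ x∈ w≢x) (In3-without₁ y∈ w≢y) (In3-without₁ z∈ w≢z)
  In3-pigeonhole (inj₂ (inj₁ refl)) x∈ y∈ z∈ w≢x w≢y w≢z =
    In2-pigeonhole (In3-without₂ x∈ w≢x) (In3-without₂ y∈ w≢y) (In3-without₂ z∈ w≢z)
  In3-pigeonhole (inj₂ (inj₂ refl)) x∈ y∈ z∈ w≢x w≢y w≢z =
    In2-pigeonhole (In3-without₃ x∈ w≢x) (In3-without₃ y∈ w≢y) (In3-without₃ z∈ w≢z)

module _ {V : Set} {H : V → V → Set} (H-sym : ∀ u w → H u w → H w u) {a b c : V}
         (H-ab : H a b) (H-bc : H b c)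
         (closed : ∀ u w → In3 a b c u → H u w → SamePair a b u w ⊎ SamePair b c u w) where

  P3-component : a ≢ b → b ≢ c → a ≢ c → ∀ v → In3 a b c v → ComponentIsP3 H v
  P3-component a≢b b≢c a≢c v v∈ =
    a , b , c , a≢b , b≢c , a≢c , H-ab , H-bc , closed ,
    λ w → walk-stays v∈ , λ w∈ → to-b v∈ ◅◅ from-b w∈
    where
    endpoint-In3 : ∀ {u w} → SamePair a b u w ⊎ SamePair b c u w → In3 a b c w
    endpoint-In3 (inj₁ (inj₁ (_ , refl))) = inj₂ (inj₁ refl)
    endpoint-In3 (inj₁ (inj₂ (_ , refl))) = inj₁ refl
    endpoint-In3 (inj₂ (inj₁ (_ , refl))) = inj₂ (inj₂ refl)
    endpoint-In3 (inj₂ (inj₂ (_ , refl))) = inj₂ (inj₁ refl)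

    walk-stays : ∀ {u w} → In3 a b c u → Star H u w → In3 a b c w
    walk-stays u∈ ε          = u∈
    walk-stays u∈ (h ◅ walk) = walk-stays (endpoint-In3 (closed _ _ u∈ h)) walk

    to-b : ∀ {u} → In3 a b c u → Star H u b
    to-b (inj₁ refl)        = H-ab ◅ ε
    to-b (inj₂ (inj₁ refl)) = ε
    to-b (inj₂ (inj₂ refl)) = H-sym _ _ H-bc ◅ ε

    from-b : ∀ {u} → In3 a b c u → Star H b u
    from-b (inj₁ refl)        = H-sym _ _ H-ab ◅ ε
    from-b (inj₂ (inj₁ refl)) = ε
    from-b (inj₂ (inj₂ refl)) = H-bc ◅ ε

ΛFactor-mono : {V : Set} {A B : V → V → Set} → (∀ u w → A u w → B u w) →
  ΛFactor A → ΛFactor B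
ΛFactor-mono A⊆B (H , H⊆A , H-sym , components) =
  H , (λ u w h → A⊆B u w (H⊆A u w h)) , H-sym , components

sucMod : ℕ → ℕ → ℕ
sucMod k i with i ℕ.≟ k
... | yes _ = 0
... | no _  = suc i

sucMod-last : ∀ k → sucMod k k ≡ 0
sucMod-last k with k ℕ.≟ k
... | yes _   = refl
... | no k≢k = contradiction refl k≢k

sucMod-< : ∀ {k i} → i < k → sucMod k i ≡ suc i
sucMod-< {k} {i} i<k with i ℕ.≟ k
... | yes refl = contradiction i<k (<-irrefl refl)
... | no _     = refl

sucMod-≤ : ∀ {k i} → i ≤ k → sucMod k i ≤ k
sucMod-≤ {k} {i} i≤k with i ℕ.≟ k
... | yes _   = z≤n
... | no i≢k = ≤∧≢⇒< i≤k i≢k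

sucMod-injective : ∀ {k i j} → sucMod k i ≡ sucMod k j → i ≡ j
sucMod-injective {k} {i} {j} eq with i ℕ.≟ k | j ℕ.≟ k
... | yes refl | yes refl = refl
... | yes _    | no _     = contradiction eq λ ()
... | no _     | yes _    = contradiction eq λ ()
... | no _     | no _     = suc-injective eq

sucMod-surjective : ∀ {k j} → j ≤ k → ∃ λ i → i ≤ k × sucMod k i ≡ j
sucMod-surjective {k} {zero}  _   = k , ≤-refl , sucMod-last k
sucMod-surjective {k} {suc j} j<k = j , <⇒≤ j<k , sucMod-< j<k

sucMod²≢id : ∀ {k} → 2 ≤ k → ∀ i → sucMod k (sucMod k i) ≢ i
sucMod²≢id {k} 2≤k i with i ℕ.≟ k
... | yes refl rewrite sucMod-< {k} {0} (≤-trans (s≤s z≤n) 2≤k) =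
  λ 1≡k → 1+n≰n (subst (2 ≤_) (sym 1≡k) 2≤k)
... | no _ with suc i ℕ.≟ k
...   | yes refl = λ { refl → 1+n≰n 2≤k }
...   | no _     = m+1+n≢n 1

record SimplePath {V : Set} (R : V → V → Set) (a b : V) : Set where
  field
    len       : ℕ
    vertex    : ℕ → V
    vertex-0  : vertex 0 ≡ a
    vertex-len : vertex len ≡ b
    step      : ∀ {i} → i < len → R (vertex i) (vertex (suc i))
    injective : ∀ {i j} → i ≤ len → j ≤ len → vertex i ≡ vertex j → i ≡ j

module _ {V : Set} (_≟ᵛ_ : DecidableEquality V) where

  occurs? : (f : ℕ → V) (a : V) (k : ℕ) → Dec (∃ λ i → i ≤ k × f i ≡ a)
  occurs? f a zero with f 0 ≟ᵛ a
  ... | yes f0≡a = yes (0 , z≤n , f0≡a)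
  ... | no f0≢a  = no λ { (0 , z≤n , f0≡a) → f0≢a f0≡a }
  occurs? f a (suc k) with f (suc k) ≟ᵛ a | occurs? f a k
  ... | yes fk≡a | _                 = yes (suc k , ≤-refl , fk≡a)
  ... | no _     | yes (i , i≤k , e) = yes (i , m≤n⇒m≤1+n i≤k , e)
  ... | no fk≢a  | no a∉             = no λ (i , i≤ , fi≡a) →
    [ (λ i≤k → a∉ (i , ≤-pred i≤k , fi≡a)) , (λ { refl → fk≢a fi≡a }) ]′ (m≤n⇒m<n∨m≡n i≤)

module _ {V : Set} {R : V → V → Set} where
  open SimplePath

  trivialPath : ∀ a → SimplePath R a a
  trivialPath a = record
    { len = 0 ; vertex = λ _ → a ; vertex-0 = refl ; vertex-len = refl
    ; step = λ () ; injective = λ { z≤n z≤n _ → refl } }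

  dropPath : ∀ {a b} (P : SimplePath R a b) {j} → j ≤ len P → SimplePath R (vertex P j) b
  dropPath P {j} j≤len = record
    { len        = len P ∸ j
    ; vertex     = λ i → vertex P (i + j)
    ; vertex-0   = refl
    ; vertex-len = trans (cong (vertex P) (m∸n+n≡m j≤len)) (vertex-len P)
    ; step       = λ {i} i< → step P (m≤o∸n⇒m+n≤o (suc i) j≤len i<)
    ; injective  = λ {i} {i'} i≤ i'≤ e →
        +-cancelʳ-≡ j i i' (injective P (m≤o∸n⇒m+n≤o i j≤len i≤) (m≤o∸n⇒m+n≤o i' j≤len i'≤) e)
    }

  consPath : ∀ {a a' b} → R a a' → (P : SimplePath R a' b) →
    (∀ {i} → i ≤ len P → vertex P i ≢ a) → SimplePath R a b
  consPath {a} r P a∉P = record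
    { len = suc (len P) ; vertex = vertex′ ; vertex-0 = refl ; vertex-len = vertex-len P
    ; step = step′ ; injective = injective′ }
    where
    vertex′ : ℕ → _
    vertex′ zero    = a
    vertex′ (suc i) = vertex P i

    step′ : ∀ {i} → i < suc (len P) → R (vertex′ i) (vertex′ (suc i))
    step′ {zero}  _         = subst (R a) (sym (vertex-0 P)) r
    step′ {suc i} (s≤s i<) = step P i<

    injective′ : ∀ {i j} → i ≤ suc (len P) → j ≤ suc (len P) → vertex′ i ≡ vertex′ j → i ≡ j
    injective′ {zero}  {zero}  _        _        _ = refl
    injective′ {zero}  {suc j} _        (s≤s j≤) e = contradiction (sym e) (a∉P j≤)
    injective′ {suc i} {zero}  (s≤s i≤) _        e = contradiction e (a∉P i≤)
    injective′ {suc i} {suc j} (s≤s i≤) (s≤s j≤) e = cong suc (injective P i≤ j≤ e)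

  walk⇒simplePath : DecidableEquality V → ∀ {a b} → Star R a b → SimplePath R a b
  walk⇒simplePath _≟ᵛ_ ε = trivialPath _
  walk⇒simplePath _≟ᵛ_ {a} {b} (_◅_ {j = a'} r walk) = shortcut (walk⇒simplePath _≟ᵛ_ walk)
    where
    shortcut : SimplePath R a' b → SimplePath R a b
    shortcut P with occurs? _≟ᵛ_ (vertex P) a (len P)
    ... | yes (j , j≤len , vj≡a) = subst (λ a → SimplePath R a b) vj≡a (dropPath P j≤len)
    ... | no a∉P                 = consPath r P (λ i≤ vi≡a → a∉P (_ , i≤ , vi≡a))

record SimpleCycle {V : Set} (R : V → V → Set) : Set where
  field
    last      : ℕ
    vertex    : ℕ → V
    step      : ∀ {i} → i ≤ last → R (vertex i) (vertex (sucMod last i))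
    injective : ∀ {i j} → i ≤ last → j ≤ last → vertex i ≡ vertex j → i ≡ j
    2≤last    : 2 ≤ last

closePath : {V : Set} {R : V → V → Set} {x a b : V} → R x a → R b x → a ≢ b → b ≢ x →
  SimplePath (λ u w → R u w × u ≢ x × w ≢ x) a b → SimpleCycle R
closePath {V} {R} {x} {a} {b} R-xa R-bx a≢b b≢x P = record
  { last = suc len ; vertex = vertex′ ; step = step′ ; injective = injective′
  ; 2≤last = s≤s 1≤len }
  where
  open SimplePath P

  vertex′ : ℕ → V
  vertex′ zero    = x
  vertex′ (suc i) = vertex i

  avoids : ∀ {i} → i ≤ len → vertex i ≢ x
  avoids i≤len with m≤n⇒m<n∨m≡n i≤len
  ... | inj₁ i<len = proj₁ (proj₂ (step i<len))
  ... | inj₂ refl  = subst (_≢ x) (sym vertex-len) b≢x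

  1≤len : 1 ≤ len
  1≤len = ≤∧≢⇒< z≤n λ 0≡len → a≢b (trans (sym vertex-0) (trans (cong vertex 0≡len) vertex-len))

  step′ : ∀ {i} → i ≤ suc len → R (vertex′ i) (vertex′ (sucMod (suc len) i))
  step′ {zero} _ = subst (R x) (sym vertex-0) R-xa
  step′ {suc i} (s≤s i≤len) with m≤n⇒m<n∨m≡n i≤len
  ... | inj₁ i<len rewrite sucMod-< (s≤s i<len) = proj₁ (step i<len)
  ... | inj₂ refl  rewrite sucMod-last (suc len) = subst (λ u → R u x) (sym vertex-len) R-bx

  injective′ : ∀ {i j} → i ≤ suc len → j ≤ suc len → vertex′ i ≡ vertex′ j → i ≡ j
  injective′ {zero}  {zero}  _        _        _ = refl
  injective′ {zero}  {suc j} _        (s≤s j≤) e = contradiction (sym e) (avoids j≤)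
  injective′ {suc i} {zero}  (s≤s i≤) _        e = contradiction e (avoids i≤)
  injective′ {suc i} {suc j} (s≤s i≤) (s≤s j≤) e = cong suc (injective i≤ j≤ e)

record OrientedCycles {V : Set} (R : V → V → Set) : Set₁ where
  field
    OnCycle         : V → Set
    onCycle?        : ∀ u → Dec (OnCycle u)
    Next            : V → V → Set
    Next⇒R          : ∀ {u v} → Next u v → R u v
    Next-source     : ∀ {u v} → Next u v → OnCycle u
    Next-target     : ∀ {u v} → Next u v → OnCycle v
    Next-functional : ∀ {u v v'} → Next u v → Next u v' → v ≡ v'
    Next-injective  : ∀ {u u' v} → Next u v → Next u' v → u ≡ u'
    successor       : ∀ {u} → OnCycle u → ∃ (Next u)
    predecessor     : ∀ {v} → OnCycle v → ∃ λ u → Next u v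
    Next-asym       : ∀ {u v} → Next u v → ¬ Next v u

noCycles : {V : Set} {R : V → V → Set} → OrientedCycles R
noCycles = record
  { OnCycle = λ _ → ⊥ ; onCycle? = λ _ → no λ () ; Next = λ _ _ → ⊥
  ; Next⇒R = λ () ; Next-source = λ () ; Next-target = λ ()
  ; Next-functional = λ () ; Next-injective = λ () ; successor = λ () ; predecessor = λ ()
  ; Next-asym = λ () }

module _ {V : Set} (_≟ᵛ_ : DecidableEquality V) {R : V → V → Set} (Z : SimpleCycle R) where
  open SimpleCycle Z

  Follows : V → V → Set
  Follows u v = ∃ λ i → i ≤ last × vertex i ≡ u × vertex (sucMod last i) ≡ v

  private
    functional : ∀ {u v v'} → Follows u v → Follows u v' → v ≡ v'
    functional (i , i≤ , refl , refl) (j , j≤ , vj≡vi , refl) =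
      cong (vertex ∘ sucMod last) (injective i≤ j≤ (sym vj≡vi))

    injective′ : ∀ {u u' v} → Follows u v → Follows u' v → u ≡ u'
    injective′ (i , i≤ , refl , refl) (j , j≤ , refl , e) =
      cong vertex (sucMod-injective (injective (sucMod-≤ i≤) (sucMod-≤ j≤) (sym e)))

    asym : ∀ {u v} → Follows u v → ¬ Follows v u
    asym (i , i≤ , refl , refl) (j , j≤ , vj≡ , vsj≡) =
      sucMod²≢id 2≤last i (trans (cong (sucMod last) (sym j≡)) sj≡)
      where
      j≡ : j ≡ sucMod last i
      j≡ = injective j≤ (sucMod-≤ i≤) vj≡
      sj≡ : sucMod last j ≡ i
      sj≡ = injective (sucMod-≤ j≤) i≤ vsj≡

  orientedCycle : OrientedCycles R
  orientedCycle = record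
    { OnCycle         = λ u → ∃ λ i → i ≤ last × vertex i ≡ u
    ; onCycle?        = λ u → occurs? _≟ᵛ_ vertex u last
    ; Next            = Follows
    ; Next⇒R          = λ { (i , i≤ , refl , refl) → step i≤ }
    ; Next-source     = λ { (i , i≤ , u≡ , _) → i , i≤ , u≡ }
    ; Next-target     = λ { (i , i≤ , _ , v≡) → sucMod last i , sucMod-≤ i≤ , v≡ }
    ; Next-functional = functional
    ; Next-injective  = injective′
    ; successor       = λ { (i , i≤ , u≡) → _ , i , i≤ , u≡ , refl }
    ; predecessor     = λ { (j , j≤ , refl) → let i , i≤ , si≡j = sucMod-surjective j≤ in
                            vertex i , i , i≤ , refl , cong vertex si≡j }
    ; Next-asym       = asym
    }

  orientedCycle-first-step : Follows (vertex 0) (vertex 1)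
  orientedCycle-first-step = 0 , z≤n , refl , cong vertex (sucMod-< (≤-trans (s≤s z≤n) 2≤last))

module _ {n : ℕ} {F : Graph n} where

  base : Dart F → Fin n
  base ((u , _) , _) = u

  head : Dart F → Fin n
  head ((_ , w) , _) = w

  InTriangle : Fin n → Dart F → Dart F → Set
  InTriangle u p q = base p ≡ u × base q ≡ u

module SimpleGraph {n : ℕ} (F : Graph n) (simple : IsSimple F) where

  Edge-sym : ∀ {u w} → Edge F u w → Edge F w u
  Edge-sym {u} {w} = subst T (proj₁ simple u w)

  Edge-irrefl : ∀ {u w} → Edge F u w → u ≢ w
  Edge-irrefl {u} uw refl = subst T (proj₂ simple u) uw

  dart-≡ : ∀ {u w u' w'} {uw : Edge F u w} {uw' : Edge F u' w'} → u ≡ u' → w ≡ w' →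
    _≡_ {A = Dart F} ((u , w) , uw) ((u' , w') , uw')
  dart-≡ {u} {w} refl refl = cong ((u , w) ,_) (T-irrelevant _ _)

  triangle-heads-differ : ∀ {x b d} {xb : Edge F x b} {xd : Edge F x d} →
    EdgeΔ F ((x , b) , xb) ((x , d) , xd) → b ≢ d
  triangle-heads-differ          (inj₁ (_ , b≢d)) = b≢d
  triangle-heads-differ {xb = xb} (inj₂ (_ , b≡x)) _ = Edge-irrefl xb (sym b≡x)

  cycle-through : TwoConnected F → ∀ {x y y'} → Edge F x y → Edge F x y' → y ≢ y' →
    Σ[ C ∈ OrientedCycles (Edge F) ] OrientedCycles.Next C x y
  cycle-through (_ , _ , no-cut-vertex) {x} {y} {y'} xy xy' y≢y' =
    orientedCycle _≟_ Z ,
    subst (OrientedCycles.Next (orientedCycle _≟_ Z) x) (SimplePath.vertex-0 P)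
          (orientedCycle-first-step _≟_ Z)
    where
    P : SimplePath (EdgeWithout F x) y y'
    P = walk⇒simplePath _≟_
          (no-cut-vertex x y y' (≢-sym (Edge-irrefl xy)) (≢-sym (Edge-irrefl xy')))
    Z : SimpleCycle (Edge F)
    Z = closePath xy (Edge-sym xy') y≢y' (≢-sym (Edge-irrefl xy')) P

module CubicGraph {n : ℕ} (F : Graph n) (cubic : Cubic F) where

  some-neighbour : ∀ u → ∃ (Edge F u)
  some-neighbour u = let y , _ , _ , _ , _ , _ , uy , _ = cubic u in y , uy

  neighbours-exhausted : ∀ {u a b c w} → Edge F u a → Edge F u b → Edge F u c →
    a ≢ b → a ≢ c → b ≢ c → Edge F u w → In3 a b c w
  neighbours-exhausted {u} {a} {b} {c} {w} ua ub uc a≢b a≢c b≢c uw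
    with cubic u | w ≟ a | w ≟ b | w ≟ c
  ... | _ | yes w≡a | _       | _       = inj₁ w≡a
  ... | _ | no _    | yes w≡b | _       = inj₂ (inj₁ w≡b)
  ... | _ | no _    | no _    | yes w≡c = inj₂ (inj₂ w≡c)
  ... | _ , _ , _ , _ , _ , _ , _ , _ , _ , nbr | no w≢a | no w≢b | no w≢c =
    ⊥-elim (In3-pigeonhole (nbr a ua) (nbr b ub) (nbr c uc) (nbr w uw)
              a≢b a≢c (≢-sym w≢a) b≢c (≢-sym w≢b) (≢-sym w≢c))

  neighbour-avoiding : ∀ u a b → ∃ λ z → Edge F u z × ¬ In2 a b z
  neighbour-avoiding u a b with cubic u
  ... | y₁ , y₂ , y₃ , y₁≢y₂ , y₁≢y₃ , y₂≢y₃ , uy₁ , uy₂ , uy₃ , _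
    with y₁ ≟ a ⊎-dec y₁ ≟ b | y₂ ≟ a ⊎-dec y₂ ≟ b | y₃ ≟ a ⊎-dec y₃ ≟ b
  ... | no y₁∉ | _      | _      = y₁ , uy₁ , y₁∉
  ... | yes _  | no y₂∉ | _      = y₂ , uy₂ , y₂∉
  ... | yes _  | yes _  | no y₃∉ = y₃ , uy₃ , y₃∉
  ... | yes y₁∈ | yes y₂∈ | yes y₃∈ = ⊥-elim (In2-pigeonhole y₁∈ y₂∈ y₃∈ y₁≢y₂ y₁≢y₃ y₂≢y₃)

  other-neighbours : ∀ {u z} → Edge F u z →
    ∃₂ λ a c → Edge F u a × Edge F u c × a ≢ z × z ≢ c × a ≢ c
  other-neighbours {u} {z} uz with cubic u
  ... | y₁ , y₂ , y₃ , y₁≢y₂ , y₁≢y₃ , y₂≢y₃ , uy₁ , uy₂ , uy₃ , nbr with nbr z uz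
  ... | inj₁ refl        = y₂ , y₃ , uy₂ , uy₃ , ≢-sym y₁≢y₂ , y₁≢y₃ , y₂≢y₃
  ... | inj₂ (inj₁ refl) = y₁ , y₃ , uy₁ , uy₃ , y₁≢y₂ , y₂≢y₃ , y₁≢y₃
  ... | inj₂ (inj₂ refl) = y₁ , y₂ , uy₁ , uy₂ , y₁≢y₃ , ≢-sym y₂≢y₃ , y₁≢y₂

  triangle-edges-meet : ∀ {u b d b' d'} → Edge F u b → Edge F u d → Edge F u b' → Edge F u d' →
    b ≢ d → b' ≢ d' → ∃ λ y → Edge F u y × In2 b d y × In2 b' d' y
  triangle-edges-meet {b = b} {d} {b'} {d'} ub ud ub' ud' b≢d b'≢d' with b ≟ b' | b ≟ d'
  ... | yes b≡b' | _        = b , ub , inj₁ refl , inj₁ b≡b'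
  ... | no _     | yes b≡d' = b , ub , inj₁ refl , inj₂ b≡d'
  ... | no b≢b'  | no b≢d'
    with neighbours-exhausted ub' ud' ub b'≢d' (≢-sym b≢b') (≢-sym b≢d') ud
  ...   | inj₁ d≡b'        = d , ud , inj₂ refl , inj₁ d≡b'
  ...   | inj₂ (inj₁ d≡d') = d , ud , inj₂ refl , inj₂ d≡d'
  ...   | inj₂ (inj₂ d≡b)  = contradiction (sym d≡b) b≢d

module ΛConstruction {n : ℕ} (F : Graph n) (simple : IsSimple F) (cubic : Cubic F)
  (cycles : OrientedCycles (Edge F)) (m : Fin n → Fin n) (m-edge : ∀ u → Edge F u (m u)) where
  open SimpleGraph F simple
  open CubicGraph F cubic
  open OrientedCycles cycles

  Kept : Fin n → Fin n → Fin n → Set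
  Kept u w w' = (OnCycle u × ¬ Next u w × ¬ Next u w' × (Next w u ⊎ Next w' u))
              ⊎ (¬ OnCycle u × In2 w w' (m u))

  Λ : Dart F → Dart F → Set
  Λ ((u , w) , _) ((u' , w') , _) =
    (u ≡ u' × w ≢ w' × Kept u w w') ⊎ (u ≡ w' × w ≡ u' × (Next u w ⊎ Next w u))

  Λ-sym : ∀ d d' → Λ d d' → Λ d' d
  Λ-sym _ _ (inj₁ (refl , w≢w' , inj₁ (on , ¬uw , ¬uw' , pred))) =
    inj₁ (refl , ≢-sym w≢w' , inj₁ (on , ¬uw' , ¬uw , swap pred))
  Λ-sym _ _ (inj₁ (refl , w≢w' , inj₂ (off , m∈))) = inj₁ (refl , ≢-sym w≢w' , inj₂ (off , swap m∈))
  Λ-sym ((u , w) , _) ((u' , w') , _) (inj₂ (refl , refl , next)) = inj₂ (refl , refl , swap next)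

  Λ⊆EdgeΔ : ∀ d d' → Λ d d' → EdgeΔ F d d'
  Λ⊆EdgeΔ _ _ (inj₁ (u≡u' , w≢w' , _)) = inj₁ (u≡u' , w≢w')
  Λ⊆EdgeΔ _ _ (inj₂ (u≡w' , w≡u' , _)) = inj₂ (u≡w' , w≡u')

  off-cycle-no-Next : ∀ {u w} → ¬ OnCycle u → ¬ (Next u w ⊎ Next w u)
  off-cycle-no-Next off = [ off ∘ Next-source , off ∘ Next-target ]′

  third-neighbour : ∀ {p v s} → Next p v → Next v s → ∃ λ z → Edge F v z × ¬ Next v z × ¬ Next z v
  third-neighbour {p} {v} {s} pv vs with neighbour-avoiding v s p
  ... | z , vz , z∉ = z , vz , (λ vz → z∉ (inj₁ (Next-functional vz vs)))
                             , (λ zv → z∉ (inj₂ (Next-injective zv pv)))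

  only-third-neighbour : ∀ {p v z w} → Next p v → Edge F v z → ¬ Next v z → ¬ Next z v →
    Edge F v w → ¬ Next v w → p ≢ w → w ≡ z
  only-third-neighbour {p} {v} {z} pv vz ¬vz ¬zv vw ¬vw p≢w
    with successor (Next-target pv)
  ... | s , vs with neighbours-exhausted (Next⇒R vs) (Edge-sym (Next⇒R pv)) vz
                      (λ { refl → Next-asym pv vs }) (λ { refl → ¬vz vs }) (λ { refl → ¬zv pv }) vw
  ...   | inj₁ refl        = contradiction vs ¬vw
  ...   | inj₂ (inj₁ refl) = contradiction refl p≢w
  ...   | inj₂ (inj₂ w≡z)  = w≡z

  cycle-component : ∀ {p v z} (pv : Next p v) (vz : Edge F v z) → ¬ Next v z → ¬ Next z v →
    ∀ d → In3 ((v , z) , vz) ((v , p) , Edge-sym (Next⇒R pv)) ((p , v) , Next⇒R pv) d →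
    ComponentIsP3 Λ d
  cycle-component {p} {v} {z} pv vz ¬vz ¬zv =
    P3-component Λ-sym Λ-ab Λ-bc closed (p≢z ∘ sym ∘ cong head) (v≢p ∘ cong base) (v≢p ∘ cong base)
    where
    a b c : Dart F
    a = (v , z) , vz
    b = (v , p) , Edge-sym (Next⇒R pv)
    c = (p , v) , Next⇒R pv

    p≢z : p ≢ z
    p≢z refl = ¬zv pv
    v≢p : v ≢ p
    v≢p refl = Next-asym pv pv

    Λ-ab : Λ a b
    Λ-ab = inj₁ (refl , ≢-sym p≢z , inj₁ (Next-target pv , ¬vz , Next-asym pv , inj₂ pv))
    Λ-bc : Λ b c
    Λ-bc = inj₂ (refl , refl , inj₂ pv)

    closed : ∀ u w → In3 a b c u → Λ u w → SamePair a b u w ⊎ SamePair b c u w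
    closed _ _ (inj₁ refl) (inj₁ (refl , _ , inj₁ (_ , _ , _ , inj₁ zv))) = contradiction zv ¬zv
    closed _ _ (inj₁ refl) (inj₁ (refl , _ , inj₁ (_ , _ , _ , inj₂ wv))) =
      inj₁ (inj₁ (refl , dart-≡ refl (Next-injective wv pv)))
    closed _ _ (inj₁ refl) (inj₁ (refl , _ , inj₂ (off , _))) = contradiction (Next-target pv) off
    closed _ _ (inj₁ refl) (inj₂ (refl , refl , next)) = ⊥-elim ([ ¬vz , ¬zv ]′ next)
    closed _ ((_ , w) , vw) (inj₂ (inj₁ refl)) (inj₁ (refl , p≢w , inj₁ (_ , _ , ¬vw , _))) =
      inj₁ (inj₂ (refl , dart-≡ refl (only-third-neighbour pv vz ¬vz ¬zv vw ¬vw p≢w)))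
    closed _ _ (inj₂ (inj₁ refl)) (inj₁ (refl , _ , inj₂ (off , _))) =
      contradiction (Next-target pv) off
    closed _ _ (inj₂ (inj₁ refl)) (inj₂ (refl , refl , inj₁ vp)) = contradiction vp (Next-asym pv)
    closed _ _ (inj₂ (inj₁ refl)) (inj₂ (refl , refl , inj₂ _)) =
      inj₂ (inj₁ (refl , dart-≡ refl refl))
    closed _ _ (inj₂ (inj₂ refl)) (inj₁ (refl , _ , inj₁ (_ , ¬pv , _))) = contradiction pv ¬pv
    closed _ _ (inj₂ (inj₂ refl)) (inj₁ (refl , _ , inj₂ (off , _))) =
      contradiction (Next-source pv) off
    closed _ _ (inj₂ (inj₂ refl)) (inj₂ (refl , refl , _)) = inj₂ (inj₂ (refl , dart-≡ refl refl))

  triangle-component : ∀ {u a c} → ¬ OnCycle u → (ua : Edge F u a) (uc : Edge F u c) →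
    a ≢ m u → m u ≢ c → a ≢ c →
    ∀ d → In3 ((u , a) , ua) ((u , m u) , m-edge u) ((u , c) , uc) d → ComponentIsP3 Λ d
  triangle-component {u} {a} {c} off ua uc a≢m m≢c a≢c =
    P3-component Λ-sym Λ-ab Λ-bc closed (a≢m ∘ cong head) (m≢c ∘ cong head) (a≢c ∘ cong head)
    where
    A B C : Dart F
    A = (u , a) , ua
    B = (u , m u) , m-edge u
    C = (u , c) , uc

    Λ-ab : Λ A B
    Λ-ab = inj₁ (refl , a≢m , inj₂ (off , inj₂ refl))
    Λ-bc : Λ B C
    Λ-bc = inj₁ (refl , m≢c , inj₂ (off , inj₁ refl))

    closed : ∀ x w → In3 A B C x → Λ x w → SamePair A B x w ⊎ SamePair B C x w
    closed _ _ (inj₁ refl)        (inj₁ (refl , _ , inj₁ (on , _))) = contradiction on off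
    closed _ _ (inj₂ (inj₁ refl)) (inj₁ (refl , _ , inj₁ (on , _))) = contradiction on off
    closed _ _ (inj₂ (inj₂ refl)) (inj₁ (refl , _ , inj₁ (on , _))) = contradiction on off
    closed _ _ (inj₁ refl)        (inj₂ (_ , _ , next)) = ⊥-elim (off-cycle-no-Next off next)
    closed _ _ (inj₂ (inj₁ refl)) (inj₂ (_ , _ , next)) = ⊥-elim (off-cycle-no-Next off next)
    closed _ _ (inj₂ (inj₂ refl)) (inj₂ (_ , _ , next)) = ⊥-elim (off-cycle-no-Next off next)
    closed _ _ (inj₁ refl) (inj₁ (refl , _ , inj₂ (_ , inj₁ m≡a))) = contradiction (sym m≡a) a≢m
    closed _ _ (inj₁ refl) (inj₁ (refl , _ , inj₂ (_ , inj₂ m≡w))) =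
      inj₁ (inj₁ (refl , dart-≡ refl (sym m≡w)))
    closed _ ((_ , w) , uw) (inj₂ (inj₁ refl)) (inj₁ (refl , m≢w , inj₂ _))
      with neighbours-exhausted ua (m-edge u) uc a≢m a≢c m≢c uw
    ... | inj₁ w≡a        = inj₁ (inj₂ (refl , dart-≡ refl w≡a))
    ... | inj₂ (inj₁ w≡m) = contradiction (sym w≡m) m≢w
    ... | inj₂ (inj₂ w≡c) = inj₂ (inj₁ (refl , dart-≡ refl w≡c))
    closed _ _ (inj₂ (inj₂ refl)) (inj₁ (refl , _ , inj₂ (_ , inj₁ m≡c))) = contradiction m≡c m≢c
    closed _ _ (inj₂ (inj₂ refl)) (inj₁ (refl , _ , inj₂ (_ , inj₂ m≡w))) =
      inj₂ (inj₂ (refl , dart-≡ refl (sym m≡w)))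

  on-cycle-component : ∀ {u w} (uw : Edge F u w) → OnCycle u → ComponentIsP3 Λ ((u , w) , uw)
  on-cycle-component {u} {w} uw on with successor on | predecessor on
  ... | s , us | p , pu with w ≟ s | w ≟ p
  ... | yes refl | _ with third-neighbour us (proj₂ (successor (Next-target us)))
  ...   | z , wz , ¬wz , ¬zw = cycle-component us wz ¬wz ¬zw _ (inj₂ (inj₂ (dart-≡ refl refl)))
  on-cycle-component uw on | s , us | p , pu | no _ | yes refl with third-neighbour pu us
  ...   | z , uz , ¬uz , ¬zu = cycle-component pu uz ¬uz ¬zu _ (inj₂ (inj₁ (dart-≡ refl refl)))
  on-cycle-component uw on | s , us | p , pu | no w≢s | no w≢p =
    cycle-component pu uw (w≢s ∘ sym ∘ Next-functional us) (w≢p ∘ (λ wu → Next-injective wu pu)) _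
      (inj₁ (dart-≡ refl refl))

  off-cycle-component : ∀ {u w} (uw : Edge F u w) → ¬ OnCycle u → ComponentIsP3 Λ ((u , w) , uw)
  off-cycle-component {u} uw off with other-neighbours (m-edge u)
  ... | a , c , ua , uc , a≢m , m≢c , a≢c =
    triangle-component off ua uc a≢m m≢c a≢c _
      (⊎.map (dart-≡ refl) (⊎.map (dart-≡ refl) (dart-≡ refl))
        (neighbours-exhausted ua (m-edge u) uc a≢m a≢c m≢c uw))

  Λ-factor : ΛFactor Λ
  Λ-factor = Λ , (λ _ _ h → h) , Λ-sym , component
    where
    component : ∀ d → ComponentIsP3 Λ d
    component ((u , w) , uw) with onCycle? u
    ... | yes on = on-cycle-component uw on
    ... | no off = off-cycle-component uw off

  Λ-off-cycle : ∀ d d' → ¬ OnCycle (base d) → Λ d d' →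
    base d ≡ base d' × In2 (head d) (head d') (m (base d))
  Λ-off-cycle _ _ off (inj₁ (_ , _ , inj₁ (on , _)))    = contradiction on off
  Λ-off-cycle _ _ off (inj₁ (u≡u' , _ , inj₂ (_ , m∈))) = u≡u' , m∈
  Λ-off-cycle _ _ off (inj₂ (_ , _ , next))             = ⊥-elim (off-cycle-no-Next off next)

  Λ-avoids-successor : ∀ {x y w w'} (xw : Edge F x w) (xw' : Edge F x w') → Next x y →
    Λ ((x , w) , xw) ((x , w') , xw') → ¬ In2 w w' y
  Λ-avoids-successor _ _   xy (inj₁ (_ , _ , inj₁ (_ , ¬xw , _ , _))) (inj₁ refl) = ¬xw xy
  Λ-avoids-successor _ _   xy (inj₁ (_ , _ , inj₁ (_ , _ , ¬xw' , _))) (inj₂ refl) = ¬xw' xy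
  Λ-avoids-successor _ _   xy (inj₁ (_ , _ , inj₂ (off , _))) _ = off (Next-source xy)
  Λ-avoids-successor _ xw' _  (inj₂ (x≡w' , _ , _)) _ = Edge-irrefl xw' x≡w'

module _ {n : ℕ} (F : Graph n) (simple : IsSimple F) (cubic : Cubic F) where
  open SimpleGraph F simple
  open CubicGraph F cubic

  separate-triangles : {p₁ q₁ p₂ q₂ : Dart F} →
    (∀ u → InTriangle u p₁ q₁ → ¬ InTriangle u p₂ q₂) →
    ΛFactor (DeleteTwo (EdgeΔ F) p₁ q₁ p₂ q₂)
  separate-triangles {p₁} {q₁} {p₂} {q₂} separate =
    ΛFactor-mono (λ d d' h → Λ⊆EdgeΔ d d' h , avoids (proj₁ ∘ avoids-both) h ,
                                              avoids (proj₂ ∘ avoids-both) h)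
                 Λ-factor
    where
    Avoids : Fin n → Fin n → Dart F → Dart F → Set
    Avoids u z p q = InTriangle u p q → ¬ In2 (head p) (head q) z

    middle : ∀ u → ∃ λ z → Edge F u z × Avoids u z p₁ q₁ × Avoids u z p₂ q₂
    middle u with base p₁ ≟ u ×-dec base q₁ ≟ u
    ... | yes in₁ = let z , uz , z∉ = neighbour-avoiding u (head p₁) (head q₁) in
                    z , uz , (λ _ → z∉) , (λ in₂ → ⊥-elim (separate u in₁ in₂))
    ... | no ¬in₁ = let z , uz , z∉ = neighbour-avoiding u (head p₂) (head q₂) in
                    z , uz , (⊥-elim ∘ ¬in₁) , (λ _ → z∉)

    m : Fin n → Fin n
    m = proj₁ ∘ middle

    avoids-both : ∀ u → Avoids u (m u) p₁ q₁ × Avoids u (m u) p₂ q₂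
    avoids-both = proj₂ ∘ proj₂ ∘ middle

    open ΛConstruction F simple cubic noCycles m (proj₁ ∘ proj₂ ∘ middle)

    avoids : ∀ {p q} → (∀ u → Avoids u (m u) p q) → ∀ {d d'} → Λ d d' → ¬ SamePair p q d d'
    avoids {p} {q} ok h (inj₁ (refl , refl)) with Λ-off-cycle p q (λ ()) h
    ... | same , m∈ = ok _ (refl , sym same) m∈
    avoids {p} {q} ok h (inj₂ (refl , refl)) with Λ-off-cycle q p (λ ()) h
    ... | same , m∈ = ok _ (sym same , refl) (swap m∈)

  common-dart : TwoConnected F → ∀ {x y} → Edge F x y →
    ∀ {b₁ d₁ b₂ d₂} {xb₁ : Edge F x b₁} {xd₁ : Edge F x d₁}
                    {xb₂ : Edge F x b₂} {xd₂ : Edge F x d₂} →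
    In2 b₁ d₁ y → In2 b₂ d₂ y →
    ΛFactor (DeleteTwo (EdgeΔ F) ((x , b₁) , xb₁) ((x , d₁) , xd₁)
                                 ((x , b₂) , xb₂) ((x , d₂) , xd₂))
  common-dart conn {x} {y} xy y∈₁ y∈₂ with neighbour-avoiding x y y
  ... | y' , xy' , y'∉ with cycle-through conn xy xy' (y'∉ ∘ inj₁ ∘ sym)
  ... | C , x→y = ΛFactor-mono (λ d d' h → Λ⊆EdgeΔ d d' h , avoids y∈₁ h , avoids y∈₂ h) Λ-factor
    where
    open ΛConstruction F simple cubic C (proj₁ ∘ some-neighbour) (proj₂ ∘ some-neighbour)

    avoids : ∀ {b d} {xb : Edge F x b} {xd : Edge F x d} → In2 b d y →
      ∀ {e e'} → Λ e e' → ¬ SamePair ((x , b) , xb) ((x , d) , xd) e e'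
    avoids {xb = xb} {xd} y∈ h (inj₁ (refl , refl)) = Λ-avoids-successor xb xd x→y h y∈
    avoids {xb = xb} {xd} y∈ h (inj₂ (refl , refl)) = Λ-avoids-successor xd xb x→y h (swap y∈)

  common-triangle : TwoConnected F →
    ∀ {x b₁ d₁ b₂ d₂} {xb₁ : Edge F x b₁} {xd₁ : Edge F x d₁}
                      {xb₂ : Edge F x b₂} {xd₂ : Edge F x d₂} →
    EdgeΔ F ((x , b₁) , xb₁) ((x , d₁) , xd₁) → EdgeΔ F ((x , b₂) , xb₂) ((x , d₂) , xd₂) →
    ΛFactor (DeleteTwo (EdgeΔ F) ((x , b₁) , xb₁) ((x , d₁) , xd₁)
                                 ((x , b₂) , xb₂) ((x , d₂) , xd₂))
  common-triangle conn {xb₁ = xb₁} {xd₁} {xb₂} {xd₂} e₁ e₂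
    with triangle-edges-meet xb₁ xd₁ xb₂ xd₂ (triangle-heads-differ {xb = xb₁} {xd₁} e₁)
                                             (triangle-heads-differ {xb = xb₂} {xd₂} e₂)
  ... | y , xy , y∈₁ , y∈₂ = common-dart conn xy y∈₁ y∈₂

mainTheorem11 : {n : ℕ} (F : Graph n) → IsSimple F → Cubic F → TwoConnected F →
    (p₁ q₁ p₂ q₂ : Dart F) → EdgeΔ F p₁ q₁ → EdgeΔ F p₂ q₂ →
    ¬ SamePair p₁ q₁ p₂ q₂ →
    ΛFactor (DeleteTwo (EdgeΔ F) p₁ q₁ p₂ q₂)
mainTheorem11 F simple cubic conn
  ((a₁ , _) , _) ((c₁ , _) , _) ((a₂ , _) , _) ((c₂ , _) , _) e₁ e₂ _
  with a₁ ≟ c₁ ×-dec a₂ ≟ a₁ ×-dec c₂ ≟ a₁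
... | yes (refl , refl , refl) = common-triangle F simple cubic conn e₁ e₂
... | no not-common = separate-triangles F simple cubic λ u (a₁≡u , c₁≡u) (a₂≡u , c₂≡u) →
  not-common (trans a₁≡u (sym c₁≡u) , trans a₂≡u (sym a₁≡u) , trans c₂≡u (sym a₁≡u))
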